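{- There is an absolute constant $C$ such that the following holds. Let $n\ge 2$, let $a_{n-1},a_n\ge 1$ be integers with $a_n/a_{n-1}$ an integer, and let $R_{n-1},R_n$ be integer intervals. Then there is a set $U \subseteq R_n^{[a_n]}$ which is a disjoint union of at most $C$ intervals of integers such that (a) $U^{[a_{n-1}]} = R_{n-1}^{[a_{n-1}]} \cap R_n^{[a_{n-1}]}$, and (b) for all $u\in U$ and $r \in R_n^{[a_n]}$, if $u \equiv r \pmod{a_{n-1}}$ then $u \leq r$.
   Context: For an integer $\alpha\ge 1$ and a set $X\subseteq\mathbb{Z}$, $X^{[\alpha]} = \{z \bmod \alpha : z \in X\}\subseteq[0,\alpha)$. -}

module Defs where

open import Data.Nat using (ℕ; zero; suc)
open import Data.Integer using (ℤ; +_; _≤_)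
open import Data.Integer.DivMod using (_%ℕ_)
open import Data.Product using (Σ; _×_; _,_)
open import Data.List using (List)
open import Data.List.Membership.Propositional using (_∈_)
open import Data.List.Relation.Unary.AllPairs using (AllPairs)
open import Relation.Nullary using (¬_)
open import Relation.Binary.PropositionalEquality using (_≡_)

Subset : Set₁
Subset = ℤ → Set

-- z mod α, the least non-negative residue (used only for α ≥ 1;
-- the zero case is an arbitrary junk value).
modℤ : ℤ → ℕ → ℤ
modℤ z zero    = z
modℤ z (suc k) = + (z %ℕ suc k)

_^[_] : Subset → ℕ → Subset
(X ^[ α ]) y = Σ ℤ (λ z → X z × modℤ z α ≡ y)

Interval : Set
Interval = ℤ × ℤ

⟦_⟧ : Interval → Subset
⟦ (l , h) ⟧ x = (l ≤ x) × (x ≤ h)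

⋃ : List Interval → Subset
⋃ Is x = Σ Interval (λ I → (I ∈ Is) × ⟦ I ⟧ x)

DisjointI : Interval → Interval → Set
DisjointI I J = ∀ x → ⟦ I ⟧ x → ¬ ⟦ J ⟧ x

PairwiseDisjoint : List Interval → Set
PairwiseDisjoint = AllPairs DisjointI

module Submission where

-- By (b), every u ∈ U is the least element of its residue class modulo a₁ in
-- T = R₂^[a₂], and by (a) U meets exactly the classes that meet both R₁ and T;
-- so U is forced to be the set of class minima of T whose class meets R₁.
-- The points of a window of length p whose class modulo p meets an interval form
-- at most two intervals; applied to the window [0, a₂) this gives T = [0,y] ∪ [x,e]
-- with y < x. The class minima of such a T modulo a₁ are the points of [0,y] below
-- a₁, together with the points of [x, x + a₁) whose residue is not already attained
-- on [0,y], i.e. whose class meets [y + 1, a₁ - 1]. Cutting these two windows down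
-- to the classes meeting R₁ with the same two-interval lemma leaves at most
-- 2 + 2 · 2 = 6 intervals.

open import Defs
open import Data.List using (List; []; _∷_; _++_; map; length)
open import Data.Product using (Σ; _×_; _,_; proj₁; proj₂)
open import Function.Base using (_∘_)
open import Function.Bundles using (_⇔_; mk⇔; module Equivalence)
open import Relation.Binary.PropositionalEquality using (_≡_; refl; sym; trans; cong; subst)
open import Relation.Unary using (_∩_; _∪_; _⊆_; _≐_; ∅)

-- The integer order is opened only inside this module: the statement of lemma13
-- below uses the order on ℕ.
module _ where

  open import Data.Nat as ℕ using (ℕ; suc)
  import Data.Nat.Properties as ℕ
  open import Data.Nat.DivMod using (m%n≤m; m<n⇒m%n≡m)
  open import Data.Nat.Divisibility using (_∣_; divides)
  open import Data.Integer as ℤ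
    using (ℤ; +_; -[1+_]; +[1+_]; 0ℤ; 1ℤ; -1ℤ; _+_; _-_; _*_; -_; _≤_; _<_; _⊓_; _⊔_; pred; +≤+; +<+)
  open import Data.Integer.Properties
  open import Data.Integer.DivMod using (_%ℕ_; _/ℕ_; n%ℕd<d; a≡a%ℕn+[a/ℕn]*n)
  open import Data.Integer.Tactic.RingSolver using (solve; solve-∀)
  open import Data.List.Properties using (length-++; length-map)
  open import Data.List.Membership.Propositional.Properties
    using (∈-++⁺ˡ; ∈-++⁺ʳ; ∈-++⁻; ∈-map⁺; ∈-map⁻)
  open import Data.List.Relation.Unary.Any using (here; there)
  import Data.List.Relation.Unary.All as All
  open import Data.List.Relation.Unary.AllPairs as AllPairs using ([]; _∷_)
  import Data.List.Relation.Unary.AllPairs.Properties as AllPairsₚ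
  open import Data.Sum using (inj₁; inj₂)
  open import Relation.Nullary using (yes; no; contradiction)

  open ≤-Reasoning

  i≤j+k⇒i-j≤k : ∀ {i j k} → i ≤ j + k → i - j ≤ k
  i≤j+k⇒i-j≤k {i} {j} {k} i≤j+k = begin
    i - j      ≤⟨ +-monoˡ-≤ (- j) i≤j+k ⟩
    j + k - j  ≡⟨ solve (j ∷ k ∷ []) ⟩
    k          ∎

  i-j≤k⇒i≤j+k : ∀ {i j k} → i - j ≤ k → i ≤ j + k
  i-j≤k⇒i≤j+k {i} {j} {k} i-j≤k = begin
    i            ≡⟨ solve (i ∷ j ∷ []) ⟩
    j + (i - j)  ≤⟨ +-monoʳ-≤ j i-j≤k ⟩
    j + k        ∎

  i<j+k⇒i-j<k : ∀ {i j k} → i < j + k → i - j < k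
  i<j+k⇒i-j<k {i} {j} {k} i<j+k = begin-strict
    i - j      <⟨ +-monoˡ-< (- j) i<j+k ⟩
    j + k - j  ≡⟨ solve (j ∷ k ∷ []) ⟩
    k          ∎

  i-k≤j-k⇒i≤j : ∀ {i j k} → i - k ≤ j - k → i ≤ j
  i-k≤j-k⇒i≤j {i} {j} {k} i-k≤j-k = begin
    i          ≡⟨ solve (i ∷ k ∷ []) ⟩
    i - k + k  ≤⟨ +-monoˡ-≤ k i-k≤j-k ⟩
    j - k + k  ≡⟨ solve (j ∷ k ∷ []) ⟩
    j          ∎

  i+j≤k⇒i≤k-j : ∀ {i j k} → i + j ≤ k → i ≤ k - j
  i+j≤k⇒i≤k-j {i} {j} {k} i+j≤k = begin
    i          ≡⟨ solve (i ∷ j ∷ []) ⟩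
    i + j - j  ≤⟨ +-monoˡ-≤ (- j) i+j≤k ⟩
    k - j      ∎

  i≤j-k⇒k+i≤j : ∀ {i j k} → i ≤ j - k → k + i ≤ j
  i≤j-k⇒k+i≤j {i} {j} {k} i≤j-k = begin
    k + i        ≤⟨ +-monoʳ-≤ k i≤j-k ⟩
    k + (j - k)  ≡⟨ solve (j ∷ k ∷ []) ⟩
    j            ∎

  0≤j⇒i≤i+j : ∀ {i j} → 0ℤ ≤ j → i ≤ i + j
  0≤j⇒i≤i+j {i} {j} 0≤j = begin
    i       ≡⟨ +-identityʳ i ⟨
    i + 0ℤ  ≤⟨ +-monoʳ-≤ i 0≤j ⟩
    i + j   ∎

  0<j⇒i-j<i : ∀ {i j} → 0ℤ < j → i - j < i
  0<j⇒i-j<i {i} {j} 0<j = begin-strict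
    i - j   <⟨ +-monoʳ-< i (neg-mono-< 0<j) ⟩
    i + 0ℤ  ≡⟨ +-identityʳ i ⟩
    i       ∎

  modℤ≡%ℕ : ∀ z p .{{_ : ℕ.NonZero p}} → modℤ z p ≡ + (z %ℕ p)
  modℤ≡%ℕ z (suc _) = refl

  module _ (p : ℕ) .{{_ : ℕ.NonZero p}} where

    0≤modℤ : ∀ z → 0ℤ ≤ modℤ z p
    0≤modℤ z = subst (0ℤ ≤_) (sym (modℤ≡%ℕ z p)) (+≤+ ℕ.z≤n)

    modℤ<p : ∀ z → modℤ z p < + p
    modℤ<p z = subst (_< + p) (sym (modℤ≡%ℕ z p)) (+<+ (n%ℕd<d z p))

    z≡modℤ+quot : ∀ z → z ≡ modℤ z p + z /ℕ p * + p
    z≡modℤ+quot z = subst (λ m → z ≡ m + z /ℕ p * + p) (sym (modℤ≡%ℕ z p)) (a≡a%ℕn+[a/ℕn]*n z p)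

    modℤ≤ : ∀ {z} → 0ℤ ≤ z → modℤ z p ≤ z
    modℤ≤ {+ n} _ = subst (_≤ + n) (sym (modℤ≡%ℕ (+ n) p)) (+≤+ (m%n≤m n p))

    modℤ-self : ∀ {v} → 0ℤ ≤ v → v < + p → modℤ v p ≡ v
    modℤ-self {+ n} _ (+<+ n<p) = trans (modℤ≡%ℕ (+ n) p) (cong +_ (m<n⇒m%n≡m n<p))

    private
      p≤w+[1+n]p : ∀ {w} n → 0ℤ ≤ w → + p ≤ w + (1ℤ + + n) * + p
      p≤w+[1+n]p {w} n 0≤w = begin
        + p                      ≡⟨ +-identityˡ (+ p) ⟨
        0ℤ + + p                 ≤⟨ +-monoˡ-≤ (+ p) 0≤w ⟩
        w + + p                  ≤⟨ +-monoʳ-≤ w (i≤i+j (+ p) (+ (n ℕ.* p))) ⟩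
        w + (+ p + + (n ℕ.* p))  ≡⟨ cong (λ np → w + (+ p + np)) (pos-* n p) ⟩
        w + (+ p + + n * + p)    ≡⟨ distrib w (+ n) (+ p) ⟩
        w + (1ℤ + + n) * + p     ∎
        where
        distrib : ∀ w n p → w + (p + n * p) ≡ w + (1ℤ + n) * p
        distrib = solve-∀

    residue-unique : ∀ {v w} k → 0ℤ ≤ v → v < + p → 0ℤ ≤ w → w < + p → v ≡ w + k * + p → v ≡ w
    residue-unique {v} {w} (+ 0) _ _ _ _ v≡w+0 = trans v≡w+0 (+-identityʳ w)
    residue-unique {v} {w} +[1+ n ] _ v<p 0≤w _ refl = contradiction (p≤w+[1+n]p n 0≤w) (<⇒≱ v<p)
    residue-unique {v} {w} -[1+ n ] 0≤v _ _ w<p v≡w-kp =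
      contradiction (subst (+ p ≤_) (sym w≡v+kp) (p≤w+[1+n]p n 0≤v)) (<⇒≱ w<p)
      where
      w≡v+kp : w ≡ v + (1ℤ + + n) * + p
      w≡v+kp = begin-equality
        w                                            ≡⟨ cancel w (+ n) (+ p) ⟩
        w + - (1ℤ + + n) * + p + (1ℤ + + n) * + p    ≡⟨ cong (_+ (1ℤ + + n) * + p) v≡w-kp ⟨
        v + (1ℤ + + n) * + p                         ∎
        where
        cancel : ∀ w n p → w ≡ w + - (1ℤ + n) * p + (1ℤ + n) * p
        cancel = solve-∀

    modℤ-≡⇒ : ∀ {u r} → modℤ u p ≡ modℤ r p → r ≡ u + (r /ℕ p - u /ℕ p) * + p
    modℤ-≡⇒ {u} {r} u≡r = begin-equality
      r                                                   ≡⟨ z≡modℤ+quot r ⟩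
      modℤ r p + r /ℕ p * + p                             ≡⟨ cong (_+ r /ℕ p * + p) u≡r ⟨
      modℤ u p + r /ℕ p * + p                             ≡⟨ regroup (modℤ u p) (r /ℕ p) (u /ℕ p) (+ p) ⟩
      modℤ u p + u /ℕ p * + p + k * + p                   ≡⟨ cong (_+ k * + p) (z≡modℤ+quot u) ⟨
      u + k * + p                                         ∎
      where
      k = r /ℕ p - u /ℕ p
      regroup : ∀ m a b p → m + a * p ≡ m + b * p + (a - b) * p
      regroup = solve-∀

    modℤ-shift : ∀ z k → modℤ (z + k * + p) p ≡ modℤ z p
    modℤ-shift z k =
      residue-unique (q + k - q′) (0≤modℤ z′) (modℤ<p z′) (0≤modℤ z) (modℤ<p z) (begin-equality
        modℤ z′ p                                  ≡⟨ cancel (modℤ z′ p) q′ (+ p) ⟩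
        modℤ z′ p + q′ * + p - q′ * + p            ≡⟨ cong (_- q′ * + p) (z≡modℤ+quot z′) ⟨
        z + k * + p - q′ * + p                     ≡⟨ cong (λ z → z + k * + p - q′ * + p) (z≡modℤ+quot z) ⟩
        modℤ z p + q * + p + k * + p - q′ * + p    ≡⟨ regroup (modℤ z p) q k q′ (+ p) ⟩
        modℤ z p + (q + k - q′) * + p              ∎)
      where
      z′ = z + k * + p
      q = z /ℕ p
      q′ = z′ /ℕ p
      cancel : ∀ m a p → m ≡ m + a * p - a * p
      cancel = solve-∀
      regroup : ∀ m a k b p → m + a * p + k * p - b * p ≡ m + (a + k - b) * p
      regroup = solve-∀

    modℤ-sub-cong : ∀ {x y} t → modℤ x p ≡ modℤ y p → modℤ (x - t) p ≡ modℤ (y - t) p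
    modℤ-sub-cong {x} {y} t x≡y = begin-equality
      modℤ (x - t) p              ≡⟨ modℤ-shift (x - t) k ⟨
      modℤ (x - t + k * + p) p    ≡⟨ cong (λ z → modℤ z p) (shuffle x t k (+ p)) ⟩
      modℤ (x + k * + p - t) p    ≡⟨ cong (λ z → modℤ (z - t) p) (modℤ-≡⇒ x≡y) ⟨
      modℤ (y - t) p              ∎
      where
      k = y /ℕ p - x /ℕ p
      shuffle : ∀ x t k p → x - t + k * p ≡ x + k * p - t
      shuffle = solve-∀

    x+modℤ[w-x]≡w-qp : ∀ x w → x + modℤ (w - x) p ≡ w + - ((w - x) /ℕ p) * + p
    x+modℤ[w-x]≡w-qp x w = begin-equality
      x + modℤ (w - x) p                          ≡⟨ cong (_+_ x) (cancel (modℤ (w - x) p) q (+ p)) ⟩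
      x + (modℤ (w - x) p + q * + p + - q * + p)  ≡⟨ cong (λ z → x + (z + - q * + p)) (z≡modℤ+quot (w - x)) ⟨
      x + (w - x + - q * + p)                     ≡⟨ shuffle x w q (+ p) ⟩
      w + - q * + p                               ∎
      where
      q = (w - x) /ℕ p
      cancel : ∀ m q p → m ≡ m + q * p + - q * p
      cancel = solve-∀
      shuffle : ∀ x w q p → x + (w - x + - q * p) ≡ w + - q * p
      shuffle = solve-∀

    modℤ[x+modℤ[w-x]]≡modℤ[w] : ∀ x w → modℤ (x + modℤ (w - x) p) p ≡ modℤ w p
    modℤ[x+modℤ[w-x]]≡modℤ[w] x w =
      trans (cong (λ z → modℤ z p) (x+modℤ[w-x]≡w-qp x w)) (modℤ-shift w (- ((w - x) /ℕ p)))

    offset-from : ∀ {l c u} k → c ≡ l + k * + p → c ≤ u → u < c + + p → modℤ (u - l) p ≡ u - c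
    offset-from {l} {c} {u} k refl c≤u u<c+p = begin-equality
      modℤ (u - l) p               ≡⟨ cong (λ z → modℤ z p) (shuffle u l k (+ p)) ⟩
      modℤ (u - c + k * + p) p     ≡⟨ modℤ-shift (u - c) k ⟩
      modℤ (u - c) p               ≡⟨ modℤ-self (i≤j⇒0≤j-i c≤u) (i<j+k⇒i-j<k u<c+p) ⟩
      u - c                        ∎
      where
      shuffle : ∀ u l k p → u - l ≡ u - (l + k * p) + k * p
      shuffle = solve-∀

    modℤ-least-in-window : ∀ {s u r} → s ≤ u → u < s + + p → s ≤ r → modℤ u p ≡ modℤ r p → u ≤ r
    modℤ-least-in-window {s} {u} {r} s≤u u<s+p s≤r u≡r = i-k≤j-k⇒i≤j (begin
      u - s           ≡⟨ modℤ-self (i≤j⇒0≤j-i s≤u) (i<j+k⇒i-j<k u<s+p) ⟨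
      modℤ (u - s) p  ≡⟨ modℤ-sub-cong s u≡r ⟩
      modℤ (r - s) p  ≤⟨ modℤ≤ (i≤j⇒0≤j-i s≤r) ⟩
      r - s           ∎)

  record ClassMeets (p : ℕ) (X : Subset) (u : ℤ) : Set where
    constructor _,_
    field
      shift  : ℤ
      member : X (u + shift * + p)

  ^[]-mono : ∀ {X Y} p → X ⊆ Y → X ^[ p ] ⊆ Y ^[ p ]
  ^[]-mono _ X⊆Y (z , z∈X , z≡y) = z , X⊆Y z∈X , z≡y

  module _ (p : ℕ) .{{_ : ℕ.NonZero p}} where

    ^[]⇒classMeets : ∀ {X y} → (X ^[ p ]) y → ClassMeets p X y
    ^[]⇒classMeets {X} (z , z∈X , refl) = z /ℕ p , subst X (z≡modℤ+quot p z) z∈X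

    classMeets⇒^[] : ∀ {X u} → ClassMeets p X u → (X ^[ p ]) (modℤ u p)
    classMeets⇒^[] {u = u} (k , u+kp∈X) = u + k * + p , u+kp∈X , modℤ-shift p u k

    ^[]⇔classMeets : ∀ {X y} → (X ^[ p ]) y ⇔ ((0ℤ ≤ y × y < + p) × ClassMeets p X y)
    ^[]⇔classMeets {X} = mk⇔
      (λ { y∈X^p@(z , _ , refl) → (0≤modℤ p z , modℤ<p p z) , ^[]⇒classMeets y∈X^p })
      (λ ((0≤y , y<p) , meets) → subst (X ^[ p ]) (modℤ-self p 0≤y y<p) (classMeets⇒^[] meets))

    residue⇒classMeets : ∀ {X u} → X (modℤ u p) → ClassMeets p X u
    residue⇒classMeets {X} {u} m∈X = - (u /ℕ p) , subst X m≡u-qp m∈X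
      where
      m≡u-qp : modℤ u p ≡ u + - (u /ℕ p) * + p
      m≡u-qp = trans (cancel (modℤ u p) (u /ℕ p) (+ p)) (cong (_+ - (u /ℕ p) * + p) (sym (z≡modℤ+quot p u)))
        where
        cancel : ∀ m q p → m ≡ m + q * p + - q * p
        cancel = solve-∀

    classMeets-cong : ∀ {X u v} → modℤ u p ≡ modℤ v p → ClassMeets p X u → ClassMeets p X v
    classMeets-cong {X} {u} {v} u≡v (k , u+kp∈X) = k - j , subst X u+kp≡v+[k-j]p u+kp∈X
      where
      j = v /ℕ p - u /ℕ p
      u+kp≡v+[k-j]p : u + k * + p ≡ v + (k - j) * + p
      u+kp≡v+[k-j]p = trans (regroup u k j (+ p)) (cong (_+ (k - j) * + p) (sym (modℤ-≡⇒ p u≡v)))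
        where
        regroup : ∀ u k j p → u + k * p ≡ u + j * p + (k - j) * p
        regroup = solve-∀

    classMeets-interval : ∀ {l h u} → ClassMeets p ⟦ l , h ⟧ u ⇔ modℤ (u - l) p ≤ h - l
    classMeets-interval {l} {h} {u} = mk⇔ offset≤ meets
      where
      offset≤ : ClassMeets p ⟦ l , h ⟧ u → modℤ (u - l) p ≤ h - l
      offset≤ (k , l≤w , w≤h) = begin
        modℤ (u - l) p            ≡⟨ modℤ-sub-cong p l (sym (modℤ-shift p u k)) ⟩
        modℤ (u + k * + p - l) p  ≤⟨ modℤ≤ p (i≤j⇒0≤j-i l≤w) ⟩
        u + k * + p - l           ≤⟨ +-monoˡ-≤ (- l) w≤h ⟩
        h - l                     ∎
      meets : modℤ (u - l) p ≤ h - l → ClassMeets p ⟦ l , h ⟧ u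
      meets m≤h-l = - ((u - l) /ℕ p) ,
        subst ⟦ l , h ⟧ (x+modℤ[w-x]≡w-qp p l u)
          (0≤j⇒i≤i+j (0≤modℤ p (u - l)) , i≤j-k⇒k+i≤j m≤h-l)

    classMeets-residue : ∀ {l h u} → 0ℤ ≤ l → h < + p →
                         ClassMeets p ⟦ l , h ⟧ u → ⟦ l , h ⟧ (modℤ u p)
    classMeets-residue {l} {h} {u} 0≤l h<p (k , l≤w , w≤h) = subst ⟦ l , h ⟧ (sym residue≡w) (l≤w , w≤h)
      where
      residue≡w : modℤ u p ≡ u + k * + p
      residue≡w = trans (sym (modℤ-shift p u k)) (modℤ-self p (≤-trans 0≤l l≤w) (≤-<-trans w≤h h<p))

  classMeets-∣ : ∀ {X u} q p → q ∣ p → ClassMeets p X u → ClassMeets q X u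
  classMeets-∣ {X} {u} q _ (divides c refl) (k , u+kp∈X) = k * + c , subst X (cong (_+_ u) kcq≡[kc]q) u+kp∈X
    where
    kcq≡[kc]q : k * + (c ℕ.* q) ≡ k * + c * + q
    kcq≡[kc]q = trans (cong (k *_) (pos-* c q)) (sym (*-assoc k (+ c) (+ q)))

  classMeets-^[] : ∀ {X y} q p .{{_ : ℕ.NonZero p}} → q ∣ p → ClassMeets q X y → ClassMeets q (X ^[ p ]) y
  classMeets-^[] {X} {y} q p (divides c refl) (k , w∈X) = k - w /ℕ p * + c , w , w∈X , modℤ[w]≡
    where
    w = y + k * + q
    modℤ[w]≡ : modℤ w p ≡ y + (k - w /ℕ p * + c) * + q
    modℤ[w]≡ = begin-equality
      modℤ w p                                   ≡⟨ cancel (modℤ w p) (w /ℕ p) (+ p) ⟩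
      modℤ w p + w /ℕ p * + p - w /ℕ p * + p     ≡⟨ cong (_- w /ℕ p * + p) (z≡modℤ+quot p w) ⟨
      w - w /ℕ p * + p                           ≡⟨ cong (λ z → w - w /ℕ p * z) (pos-* c q) ⟩
      y + k * + q - w /ℕ p * (+ c * + q)         ≡⟨ regroup y k (w /ℕ p) (+ c) (+ q) ⟩
      y + (k - w /ℕ p * + c) * + q               ∎
      where
      cancel : ∀ m a p → m ≡ m + a * p - a * p
      cancel = solve-∀
      regroup : ∀ y k a c q → y + k * q - a * (c * q) ≡ y + (k - a * c) * q
      regroup = solve-∀

  record TwoBlocks (s : ℤ) (X : Subset) : Set where
    field
      split end₁ end₂ : ℤ
      s<split         : s < split
      end₁<split      : end₁ < split
      blocks          : X ≐ ⟦ s , end₁ ⟧ ∪ ⟦ split , end₂ ⟧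

  twoBlocks-resp-≐ : ∀ {s X Y} → X ≐ Y → TwoBlocks s Y → TwoBlocks s X
  twoBlocks-resp-≐ (X⊆Y , Y⊆X) B = record
    { split      = split
    ; end₁       = end₁
    ; end₂       = end₂
    ; s<split    = s<split
    ; end₁<split = end₁<split
    ; blocks     = (λ u∈X → proj₁ blocks (X⊆Y u∈X)) , (λ u∈ → Y⊆X (proj₂ blocks u∈))
    }
    where open TwoBlocks B

  -- With c the last point of l's class at or below s, the window [s, e] lies in
  -- [c, c + 2p), and there the class of u meets [l, h] iff u ∈ [c, c + (h - l)] or
  -- u ∈ [c + p, c + p + (h - l)].
  classMeets-window : ∀ p .{{_ : ℕ.NonZero p}} {s e} (R : Interval) → e < s + + p →
                      TwoBlocks s (⟦ s , e ⟧ ∩ ClassMeets p ⟦ R ⟧)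
  classMeets-window p {s} {e} (l , h) e<s+p = record
    { split      = x
    ; end₁       = e ⊓ ((c + d) ⊓ pred x)
    ; end₂       = e ⊓ (x + d)
    ; s<split    = s<x
    ; end₁<split = ≤-<-trans (≤-trans (i⊓j≤j e _) (i⊓j≤j (c + d) (pred x))) (i≤pred[j]⇒i<j ≤-refl)
    ; blocks     = split-window , join-window
    }
    where
    q = (s - l) /ℕ p
    c = l + q * + p
    x = c + + p
    d = h - l
    x≡l+[q+1]p : x ≡ l + (q + 1ℤ) * + p
    x≡l+[q+1]p = distrib l q (+ p)
      where
      distrib : ∀ l q p → l + q * p + p ≡ l + (q + 1ℤ) * p
      distrib = solve-∀
    s≡c+modℤ[s-l] : s ≡ c + modℤ (s - l) p
    s≡c+modℤ[s-l] = begin-equality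
      s                                ≡⟨ shuffle s l ⟩
      l + (s - l)                      ≡⟨ cong (_+_ l) (z≡modℤ+quot p (s - l)) ⟩
      l + (modℤ (s - l) p + q * + p)   ≡⟨ regroup l (modℤ (s - l) p) (q * + p) ⟩
      c + modℤ (s - l) p               ∎
      where
      shuffle : ∀ s l → s ≡ l + (s - l)
      shuffle = solve-∀
      regroup : ∀ l m qp → l + (m + qp) ≡ l + qp + m
      regroup = solve-∀
    c≤s : c ≤ s
    c≤s = subst (c ≤_) (sym s≡c+modℤ[s-l]) (0≤j⇒i≤i+j (0≤modℤ p (s - l)))
    s<x : s < x
    s<x = subst (_< x) (sym s≡c+modℤ[s-l]) (+-monoʳ-< c (modℤ<p p (s - l)))
    u<x+p : ∀ {u} → u ≤ e → u < x + + p
    u<x+p u≤e = <-trans (≤-<-trans u≤e e<s+p) (+-monoˡ-< (+ p) s<x)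

    offset-low : ∀ {u} → s ≤ u → u < x → modℤ (u - l) p ≡ u - c
    offset-low s≤u u<x = offset-from p q refl (≤-trans c≤s s≤u) u<x
    offset-high : ∀ {u} → x ≤ u → u ≤ e → modℤ (u - l) p ≡ u - x
    offset-high x≤u u≤e = offset-from p (q + 1ℤ) x≡l+[q+1]p x≤u (u<x+p u≤e)

    split-window : ⟦ s , e ⟧ ∩ ClassMeets p ⟦ l , h ⟧ ⊆ ⟦ s , _ ⟧ ∪ ⟦ x , _ ⟧
    split-window {u} ((s≤u , u≤e) , meets) with u <? x
    ... | yes u<x = inj₁ (s≤u , ⊓-glb u≤e (⊓-glb (i-j≤k⇒i≤j+k u-c≤d) (i<j⇒i≤pred[j] u<x)))
      where
      u-c≤d = subst (_≤ d) (offset-low s≤u u<x) (Equivalence.to (classMeets-interval p) meets)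
    ... | no u≮x = inj₂ (≮⇒≥ u≮x , ⊓-glb u≤e (i-j≤k⇒i≤j+k u-x≤d))
      where
      u-x≤d = subst (_≤ d) (offset-high (≮⇒≥ u≮x) u≤e) (Equivalence.to (classMeets-interval p) meets)

    join-window : ⟦ s , _ ⟧ ∪ ⟦ x , _ ⟧ ⊆ ⟦ s , e ⟧ ∩ ClassMeets p ⟦ l , h ⟧
    join-window {u} (inj₁ (s≤u , u≤end₁)) =
      (s≤u , i≤j⊓k⇒i≤j e _ u≤end₁) ,
      Equivalence.from (classMeets-interval p)
        (subst (_≤ d) (sym (offset-low s≤u u<x)) (i≤j+k⇒i-j≤k (i≤j⊓k⇒i≤j _ _ u≤c+d⊓pred[x])))
      where
      u≤c+d⊓pred[x] = i≤j⊓k⇒i≤k e _ u≤end₁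
      u<x = i≤pred[j]⇒i<j (i≤j⊓k⇒i≤k _ _ u≤c+d⊓pred[x])
    join-window {u} (inj₂ (x≤u , u≤end₂)) =
      (≤-trans (<⇒≤ s<x) x≤u , u≤e) ,
      Equivalence.from (classMeets-interval p)
        (subst (_≤ d) (sym (offset-high x≤u u≤e)) (i≤j+k⇒i-j≤k (i≤j⊓k⇒i≤k e _ u≤end₂)))
      where
      u≤e = i≤j⊓k⇒i≤j e _ u≤end₂

  record UnionOfIntervals (n : ℕ) (X : Subset) : Set where
    field
      intervals : List Interval
      length≤   : length intervals ℕ.≤ n
      disjoint  : PairwiseDisjoint intervals
      covers    : ⋃ intervals ≐ X

  open UnionOfIntervals public

  _∩ᵢ_ : Interval → Interval → Interval
  (l , h) ∩ᵢ (l′ , h′) = (l ⊔ l′ , h ⊓ h′)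

  ⟦∩ᵢ⟧ : ∀ I J → ⟦ I ∩ᵢ J ⟧ ≐ ⟦ I ⟧ ∩ ⟦ J ⟧
  ⟦∩ᵢ⟧ (l , h) (l′ , h′) =
    (λ (l⊔l′≤u , u≤h⊓h′) → (i⊔j≤k⇒i≤k l l′ l⊔l′≤u , i≤j⊓k⇒i≤j h h′ u≤h⊓h′) ,
                            (i⊔j≤k⇒j≤k l l′ l⊔l′≤u , i≤j⊓k⇒i≤k h h′ u≤h⊓h′)) ,
    (λ ((l≤u , u≤h) , (l′≤u , u≤h′)) → ⊔-lub l≤u l′≤u , ⊓-glb u≤h u≤h′)

  union-resp-≐ : ∀ {n X Y} → X ≐ Y → UnionOfIntervals n X → UnionOfIntervals n Y
  union-resp-≐ (X⊆Y , Y⊆X) U = record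
    { intervals = intervals U
    ; length≤   = length≤ U
    ; disjoint  = disjoint U
    ; covers    = (λ u∈⋃ → X⊆Y (proj₁ (covers U) u∈⋃)) , (λ u∈Y → proj₂ (covers U) (Y⊆X u∈Y))
    }

  union-weaken : ∀ {m n X} → m ℕ.≤ n → UnionOfIntervals m X → UnionOfIntervals n X
  union-weaken m≤n U = record
    { intervals = intervals U
    ; length≤   = ℕ.≤-trans (length≤ U) m≤n
    ; disjoint  = disjoint U
    ; covers    = covers U
    }

  union-∅ : UnionOfIntervals 0 ∅
  union-∅ = record
    { intervals = []
    ; length≤   = ℕ.z≤n
    ; disjoint  = []
    ; covers    = (λ { (_ , () , _) }) , λ ()
    }

  union-interval : ∀ I → UnionOfIntervals 1 ⟦ I ⟧
  union-interval I = record
    { intervals = I ∷ []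
    ; length≤   = ℕ.≤-refl
    ; disjoint  = All.[] ∷ []
    ; covers    = (λ { (_ , here refl , u∈I) → u∈I }) , (λ u∈I → I , here refl , u∈I)
    }

  union-∪ : ∀ {m n X Y} → UnionOfIntervals m X → UnionOfIntervals n Y → X ∩ Y ⊆ ∅ →
            UnionOfIntervals (m ℕ.+ n) (X ∪ Y)
  union-∪ {m} {n} {X} {Y} UX UY X∩Y⊆∅ = record
    { intervals = intervals UX ++ intervals UY
    ; length≤   = subst (ℕ._≤ m ℕ.+ n) (sym (length-++ (intervals UX)))
                    (ℕ.+-mono-≤ (length≤ UX) (length≤ UY))
    ; disjoint  = AllPairsₚ.++⁺ (disjoint UX) (disjoint UY)
                    (All.tabulate λ I∈ → All.tabulate λ J∈ u u∈I u∈J →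
                      X∩Y⊆∅ (proj₁ (covers UX) (_ , I∈ , u∈I) , proj₁ (covers UY) (_ , J∈ , u∈J)))
    ; covers    = split , join
    }
    where
    split : ⋃ (intervals UX ++ intervals UY) ⊆ X ∪ Y
    split (I , I∈ , u∈I) with ∈-++⁻ (intervals UX) I∈
    ... | inj₁ I∈X = inj₁ (proj₁ (covers UX) (I , I∈X , u∈I))
    ... | inj₂ I∈Y = inj₂ (proj₁ (covers UY) (I , I∈Y , u∈I))
    join : X ∪ Y ⊆ ⋃ (intervals UX ++ intervals UY)
    join (inj₁ u∈X) with proj₂ (covers UX) u∈X
    ... | I , I∈ , u∈I = I , ∈-++⁺ˡ I∈ , u∈I
    join (inj₂ u∈Y) with proj₂ (covers UY) u∈Y
    ... | I , I∈ , u∈I = I , ∈-++⁺ʳ (intervals UX) I∈ , u∈I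

  union-∩ᵢ : ∀ {n Y} I → UnionOfIntervals n Y → UnionOfIntervals n (⟦ I ⟧ ∩ Y)
  union-∩ᵢ {n} {Y} I U = record
    { intervals = map (I ∩ᵢ_) (intervals U)
    ; length≤   = subst (ℕ._≤ n) (sym (length-map (I ∩ᵢ_) (intervals U))) (length≤ U)
    ; disjoint  = AllPairsₚ.map⁺ (AllPairs.map restrict (disjoint U))
    ; covers    = split , join
    }
    where
    restrict : ∀ {J J′} → DisjointI J J′ → DisjointI (I ∩ᵢ J) (I ∩ᵢ J′)
    restrict {J} {J′} J#J′ u u∈I∩J u∈I∩J′ =
      J#J′ u (proj₂ (proj₁ (⟦∩ᵢ⟧ I J) u∈I∩J)) (proj₂ (proj₁ (⟦∩ᵢ⟧ I J′) u∈I∩J′))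
    split : ⋃ (map (I ∩ᵢ_) (intervals U)) ⊆ ⟦ I ⟧ ∩ Y
    split (_ , K∈ , u∈K) with ∈-map⁻ (I ∩ᵢ_) K∈
    ... | J , J∈ , refl with proj₁ (⟦∩ᵢ⟧ I J) u∈K
    ... | u∈I , u∈J = u∈I , proj₁ (covers U) (J , J∈ , u∈J)
    join : ⟦ I ⟧ ∩ Y ⊆ ⋃ (map (I ∩ᵢ_) (intervals U))
    join (u∈I , u∈Y) with proj₂ (covers U) u∈Y
    ... | J , J∈ , u∈J = I ∩ᵢ J , ∈-map⁺ (I ∩ᵢ_) J∈ , proj₂ (⟦∩ᵢ⟧ I J) (u∈I , u∈J)

  union-∩ : ∀ {m n X Y} → UnionOfIntervals m X → UnionOfIntervals n Y → UnionOfIntervals (m ℕ.* n) (X ∩ Y)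
  union-∩ {m} {n} {X} {Y} UX UY =
    union-resp-≐ ⋃∩Y≐X∩Y
      (union-weaken (ℕ.*-monoˡ-≤ n (length≤ UX)) (distrib (intervals UX) (disjoint UX)))
    where
    ⋃∩Y≐X∩Y : ⋃ (intervals UX) ∩ Y ≐ X ∩ Y
    ⋃∩Y≐X∩Y = (λ (u∈⋃ , u∈Y) → proj₁ (covers UX) u∈⋃ , u∈Y) ,
              (λ (u∈X , u∈Y) → proj₂ (covers UX) u∈X , u∈Y)
    distrib : ∀ Is → PairwiseDisjoint Is → UnionOfIntervals (length Is ℕ.* n) (⋃ Is ∩ Y)
    distrib [] _ = union-resp-≐ ((λ ()) , λ { ((_ , () , _) , _) }) union-∅
    distrib (I ∷ Is) (I#Is ∷ Is-disjoint) =
      union-resp-≐ (split , join) (union-∪ (union-∩ᵢ I UY) (distrib Is Is-disjoint) apart)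
      where
      apart : (⟦ I ⟧ ∩ Y) ∩ (⋃ Is ∩ Y) ⊆ ∅
      apart ((u∈I , _) , ((J , J∈ , u∈J) , _)) = All.lookup I#Is J∈ _ u∈I u∈J
      split : (⟦ I ⟧ ∩ Y) ∪ (⋃ Is ∩ Y) ⊆ ⋃ (I ∷ Is) ∩ Y
      split (inj₁ (u∈I , u∈Y)) = (I , here refl , u∈I) , u∈Y
      split (inj₂ ((J , J∈ , u∈J) , u∈Y)) = (J , there J∈ , u∈J) , u∈Y
      join : ⋃ (I ∷ Is) ∩ Y ⊆ (⟦ I ⟧ ∩ Y) ∪ (⋃ Is ∩ Y)
      join ((_ , here refl , u∈I) , u∈Y) = inj₁ (u∈I , u∈Y)
      join ((J , there J∈ , u∈J) , u∈Y) = inj₂ ((J , J∈ , u∈J) , u∈Y)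

  twoBlocks⇒union : ∀ {s X} → TwoBlocks s X → UnionOfIntervals 2 X
  twoBlocks⇒union B =
    union-resp-≐ (proj₂ blocks , proj₁ blocks) (union-∪ (union-interval _) (union-interval _) apart)
    where
    open TwoBlocks B
    apart : ⟦ _ , end₁ ⟧ ∩ ⟦ split , _ ⟧ ⊆ ∅
    apart ((_ , u≤end₁) , (split≤u , _)) =
      <-irrefl refl (≤-<-trans split≤u (≤-<-trans u≤end₁ end₁<split))

  ClassMinimum : ℕ → Subset → Subset
  ClassMinimum p T u = T u × (∀ r → T r → modℤ u p ≡ modℤ r p → u ≤ r)

  module ClassMinima (a : ℕ) .{{_ : ℕ.NonZero a}} {T : Subset} (T-blocks : TwoBlocks 0ℤ T) where

    open TwoBlocks T-blocks renaming (split to x; end₁ to y; end₂ to e)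

    -- Fresh holds the residues modulo a that do not occur on the low block [0, y].
    Low High Fresh : Interval
    Low   = (0ℤ , y ⊓ pred (+ a))
    High  = (x , e ⊓ pred (x + + a))
    Fresh = (ℤ.suc y , pred (+ a))

    private
      0<a : 0ℤ < + a
      0<a = ≤-<-trans (0≤modℤ a 0ℤ) (modℤ<p a 0ℤ)

      T-nonneg : ∀ {r} → T r → 0ℤ ≤ r
      T-nonneg r∈T with proj₁ blocks r∈T
      ... | inj₁ (0≤r , _) = 0≤r
      ... | inj₂ (x≤r , _) = ≤-trans (<⇒≤ s<split) x≤r

      low⊆T : ∀ {u} → 0ℤ ≤ u → u ≤ y → T u
      low⊆T 0≤u u≤y = proj₂ blocks (inj₁ (0≤u , u≤y))

      high⊆T : ∀ {u} → x ≤ u → u ≤ e → T u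
      high⊆T x≤u u≤e = proj₂ blocks (inj₂ (x≤u , u≤e))

      modℤ-idem : ∀ u → modℤ u a ≡ modℤ (modℤ u a) a
      modℤ-idem u = sym (modℤ-self a (0≤modℤ a u) (modℤ<p a u))

    low-meets : ∀ R → UnionOfIntervals 2 (⟦ Low ⟧ ∩ ClassMeets a ⟦ R ⟧)
    low-meets R = twoBlocks⇒union (classMeets-window a R (≤-<-trans (i⊓j≤j y _) (i≤pred[j]⇒i<j ≤-refl)))

    high-meets : ∀ R → UnionOfIntervals 2 (⟦ High ⟧ ∩ ClassMeets a ⟦ R ⟧)
    high-meets R = twoBlocks⇒union (classMeets-window a R (≤-<-trans (i⊓j≤j e _) (i≤pred[j]⇒i<j ≤-refl)))

    low#high : ⟦ Low ⟧ ∩ ⟦ High ⟧ ⊆ ∅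
    low#high ((_ , u≤low) , (x≤u , _)) = <⇒≱ (≤-<-trans (i≤j⊓k⇒i≤j _ _ u≤low) end₁<split) x≤u

    minimum⊆ : ClassMinimum a T ⊆ ⟦ Low ⟧ ∪ (⟦ High ⟧ ∩ ClassMeets a ⟦ Fresh ⟧)
    minimum⊆ {u} (u∈T , least) with proj₁ blocks u∈T
    ... | inj₁ (0≤u , u≤y) = inj₁ (0≤u , ⊓-glb u≤y (i<j⇒i≤pred[j] u<a))
      where
      u≤residue : u ≤ modℤ u a
      u≤residue = least _ (low⊆T (0≤modℤ a u) (≤-trans (modℤ≤ a 0≤u) u≤y)) (modℤ-idem u)
      u<a = ≤-<-trans u≤residue (modℤ<p a u)
    ... | inj₂ (x≤u , u≤e) =
      inj₂ ((x≤u , ⊓-glb u≤e (i<j⇒i≤pred[j] u<x+a)) ,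
            residue⇒classMeets a (i<j⇒suc[i]≤j y<residue , i<j⇒i≤pred[j] (modℤ<p a u)))
      where
      u<x+a : u < x + + a
      u<x+a with u <? x + + a
      ... | yes u<x+a = u<x+a
      ... | no u≮x+a = contradiction (least (u - + a) u-a∈T u≡u-a) (<⇒≱ (0<j⇒i-j<i 0<a))
        where
        u-a∈T = high⊆T (i+j≤k⇒i≤k-j (≮⇒≥ u≮x+a)) (≤-trans (i-j≤i u (+ a)) u≤e)
        u≡u-a : modℤ u a ≡ modℤ (u - + a) a
        u≡u-a = sym (trans (cong (λ z → modℤ (u + z) a) (sym (-1*i≡-i (+ a)))) (modℤ-shift a u -1ℤ))
      y<residue : y < modℤ u a
      y<residue with y <? modℤ u a
      ... | yes y<t = y<t
      ... | no y≮t = contradiction (≤-<-trans u≤t (≤-<-trans (≮⇒≥ y≮t) end₁<split)) (≤⇒≯ x≤u)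
        where
        u≤t = least _ (low⊆T (0≤modℤ a u) (≮⇒≥ y≮t)) (modℤ-idem u)

    minimum⊇ : ⟦ Low ⟧ ∪ (⟦ High ⟧ ∩ ClassMeets a ⟦ Fresh ⟧) ⊆ ClassMinimum a T
    minimum⊇ {u} (inj₁ (0≤u , u≤low)) =
      low⊆T 0≤u (i≤j⊓k⇒i≤j _ _ u≤low) ,
      λ r r∈T → modℤ-least-in-window a 0≤u (i≤pred[j]⇒i<j (i≤j⊓k⇒i≤k _ _ u≤low)) (T-nonneg r∈T)
    minimum⊇ {u} (inj₂ ((x≤u , u≤high) , fresh)) = high⊆T x≤u (i≤j⊓k⇒i≤j _ _ u≤high) , least
      where
      least : ∀ r → T r → modℤ u a ≡ modℤ r a → u ≤ r
      least r r∈T u≡r with proj₁ blocks r∈T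
      ... | inj₂ (x≤r , _) =
        modℤ-least-in-window a x≤u (i≤pred[j]⇒i<j (i≤j⊓k⇒i≤k _ _ u≤high)) x≤r u≡r
      ... | inj₁ (0≤r , r≤y) = contradiction (suc[i]≤j⇒i<j suc[y]≤y) (<-irrefl refl)
        where
        0≤suc[y] = ≤-trans 0≤r (≤-trans r≤y (i≤suc[i] y))
        suc[y]≤residue = proj₁ (classMeets-residue a 0≤suc[y] (i≤pred[j]⇒i<j ≤-refl) fresh)
        suc[y]≤y = ≤-trans suc[y]≤residue (≤-trans (≤-reflexive u≡r) (≤-trans (modℤ≤ a 0≤r) r≤y))

    minimum-exists : ∀ {v} → ClassMeets a T v → Σ ℤ λ u → ClassMinimum a T u × modℤ u a ≡ modℤ v a
    minimum-exists {v} (k , w∈T) with modℤ v a ≤? y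
    ... | yes t≤y =
      modℤ v a , minimum⊇ (inj₁ (0≤modℤ a v , ⊓-glb t≤y (i<j⇒i≤pred[j] (modℤ<p a v)))) , sym (modℤ-idem v)
    ... | no t≰y with proj₁ blocks w∈T
    ...   | inj₁ (0≤w , w≤y) =
      contradiction (≤-trans (≤-reflexive t≡modℤ[w]) (≤-trans (modℤ≤ a 0≤w) w≤y)) t≰y
      where
      t≡modℤ[w] = sym (modℤ-shift a v k)
    ...   | inj₂ (x≤w , w≤e) =
      u , minimum⊇ (inj₂ ((x≤u , ⊓-glb (≤-trans u≤w w≤e) (i<j⇒i≤pred[j] u<x+a)) , fresh)) , u≡v
      where
      w = v + k * + a
      u = x + modℤ (w - x) a
      x≤u = 0≤j⇒i≤i+j (0≤modℤ a (w - x))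
      u≤w = i≤j-k⇒k+i≤j (modℤ≤ a (i≤j⇒0≤j-i x≤w))
      u<x+a = +-monoʳ-< x (modℤ<p a (w - x))
      u≡v : modℤ u a ≡ modℤ v a
      u≡v = trans (modℤ[x+modℤ[w-x]]≡modℤ[w] a x w) (modℤ-shift a v k)
      fresh : ClassMeets a ⟦ Fresh ⟧ u
      fresh = residue⇒classMeets a
        (subst ⟦ Fresh ⟧ (sym u≡v) (i<j⇒suc[i]≤j (≰⇒> t≰y) , i<j⇒i≤pred[j] (modℤ<p a v)))

  module Construction (a₁ a₂ : ℕ) .{{_ : ℕ.NonZero a₁}} .{{_ : ℕ.NonZero a₂}} (a₁∣a₂ : a₁ ∣ a₂)
                      (R₁ R₂ : Interval) where

    T : Subset
    T = ⟦ R₂ ⟧ ^[ a₂ ]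

    T-blocks : TwoBlocks 0ℤ T
    T-blocks = twoBlocks-resp-≐ T≐window (classMeets-window a₂ R₂ (i≤pred[j]⇒i<j ≤-refl))
      where
      T≐window : T ≐ ⟦ 0ℤ , pred (+ a₂) ⟧ ∩ ClassMeets a₂ ⟦ R₂ ⟧
      T≐window =
        (λ t∈T → let ((0≤t , t<a₂) , meets) = Equivalence.to (^[]⇔classMeets a₂) t∈T
                 in (0≤t , i<j⇒i≤pred[j] t<a₂) , meets) ,
        (λ ((0≤t , t≤pred[a₂]) , meets) →
           Equivalence.from (^[]⇔classMeets a₂) ((0≤t , i≤pred[j]⇒i<j t≤pred[a₂]) , meets))

    open ClassMinima a₁ T-blocks

    U : Subset
    U = ClassMinimum a₁ T ∩ ClassMeets a₁ ⟦ R₁ ⟧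

    U-intervals : UnionOfIntervals 6 U
    U-intervals =
      union-resp-≐ (regroup , ungroup)
        (union-∪ (low-meets R₁) (union-∩ (high-meets Fresh) (high-meets R₁))
          (λ ((u∈L , _) , ((u∈H , _) , _)) → low#high (u∈L , u∈H)))
      where
      Pieces : Subset
      Pieces = (⟦ Low ⟧ ∩ ClassMeets a₁ ⟦ R₁ ⟧) ∪
               ((⟦ High ⟧ ∩ ClassMeets a₁ ⟦ Fresh ⟧) ∩ (⟦ High ⟧ ∩ ClassMeets a₁ ⟦ R₁ ⟧))
      regroup : Pieces ⊆ U
      regroup (inj₁ (u∈L , meets₁)) = minimum⊇ (inj₁ u∈L) , meets₁
      regroup (inj₂ ((u∈H , fresh) , (_ , meets₁))) = minimum⊇ (inj₂ (u∈H , fresh)) , meets₁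
      ungroup : U ⊆ Pieces
      ungroup (u∈M , meets₁) with minimum⊆ u∈M
      ... | inj₁ u∈L = inj₁ (u∈L , meets₁)
      ... | inj₂ (u∈H , fresh) = inj₂ ((u∈H , fresh) , (u∈H , meets₁))

    U^[a₁] : ∀ y → (U ^[ a₁ ]) y ⇔ ((⟦ R₁ ⟧ ^[ a₁ ]) y × (⟦ R₂ ⟧ ^[ a₁ ]) y)
    U^[a₁] y = mk⇔ image⊆ image⊇
      where
      image⊆ : (U ^[ a₁ ]) y → (⟦ R₁ ⟧ ^[ a₁ ]) y × (⟦ R₂ ⟧ ^[ a₁ ]) y
      image⊆ (u , ((u∈T , _) , meets₁) , refl) =
        classMeets⇒^[] a₁ meets₁ ,
        classMeets⇒^[] a₁ (classMeets-∣ a₁ a₂ a₁∣a₂ (proj₂ (Equivalence.to (^[]⇔classMeets a₂) u∈T)))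
      image⊇ : (⟦ R₁ ⟧ ^[ a₁ ]) y × (⟦ R₂ ⟧ ^[ a₁ ]) y → (U ^[ a₁ ]) y
      image⊇ (y∈R₁^[a₁] , y∈R₂^[a₁]) with Equivalence.to (^[]⇔classMeets a₁) y∈R₁^[a₁]
      ... | (0≤y , y<a₁) , meets₁ with minimum-exists (classMeets-^[] a₁ a₂ a₁∣a₂ (^[]⇒classMeets a₁ y∈R₂^[a₁]))
      ... | u , u∈M , u≡y =
        u , (u∈M , classMeets-cong a₁ (sym u≡y) meets₁) , trans u≡y (modℤ-self a₁ 0≤y y<a₁)

open import Data.Nat using (ℕ; _≤_; suc)
open import Data.Nat.Divisibility using (_∣_)
import Data.Integer

lemma13 : Σ ℕ λ C →
    (n : ℕ) → 2 ≤ n →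
    (a₁ a₂ : ℕ) → 1 ≤ a₁ → 1 ≤ a₂ → a₁ ∣ a₂ →
    (R₁ R₂ : Interval) →
    Σ (List Interval) λ Is →
      (length Is ≤ C) ×
      PairwiseDisjoint Is ×
      (∀ u → ⋃ Is u → (⟦ R₂ ⟧ ^[ a₂ ]) u) ×
      (∀ y → ((⋃ Is ^[ a₁ ]) y ⇔ ((⟦ R₁ ⟧ ^[ a₁ ]) y × (⟦ R₂ ⟧ ^[ a₁ ]) y))) ×
      (∀ u r → ⋃ Is u → (⟦ R₂ ⟧ ^[ a₂ ]) r →
        modℤ u a₁ ≡ modℤ r a₁ → u Data.Integer.≤ r)
-- The index n (and n ≥ 2) only places a₁, a₂ in the paper's sequence.
lemma13 = 6 , λ where
  _ _ a₁@(suc _) a₂@(suc _) _ _ a₁∣a₂ R₁ R₂ →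
    let open Construction a₁ a₂ a₁∣a₂ R₁ R₂
        (⋃⊆U , U⊆⋃) = covers U-intervals
    in intervals U-intervals , length≤ U-intervals , disjoint U-intervals ,
       (λ _ u∈⋃ → proj₁ (proj₁ (⋃⊆U u∈⋃))) ,
       (λ y → mk⇔ (Equivalence.to (U^[a₁] y) ∘ ^[]-mono a₁ ⋃⊆U)
                  (^[]-mono a₁ U⊆⋃ ∘ Equivalence.from (U^[a₁] y))) ,
       (λ u r u∈⋃ → proj₂ (proj₁ (⋃⊆U u∈⋃)) r)
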